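{- Let $G$ be a graph containing neither a bull nor a chair as an induced subgraph, and let $\overline{Q}$ be an induced odd antihole in $G$ on vertices $v_1,\ldots,v_p$ ($p\geq 5$ odd), where $v_iv_j$ is a non-edge of $G$ exactly when $j\equiv i\pm1\pmod p$. If a vertex $w\in V(G)\setminus V(\overline{Q})$ is adjacent to at least one vertex of $\overline{Q}$, then $w$ has no two consecutive non-neighbors in $\overline{Q}$, i.e. there is no $i$ with $wv_i\notin E(G)$ and $wv_{i+1}\notin E(G)$ (indices modulo $p$).
   Context: A bull is the graph with vertices $v_1,\ldots,v_5$ and edges $v_1v_2,v_2v_3,v_3v_4,v_4v_5,v_2v_4$. A chair is the graph obtained from $K_{1,3}$ by subdividing one edge once. An odd antihole is an induced subgraph whose complement is a cycle of odd length at least $5$; here its vertices are labeled along the cycle of the complement. -}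

module Defs where

open import Level using (Level; _⊔_)
open import Data.Nat using (ℕ; _+_; _%_; _≤_; NonZero)

open import Data.Fin using (Fin; toℕ; zero; suc)
open import Data.Product using (_×_; Σ; ∃; _,_)
open import Data.Sum using (_⊎_)
open import Relation.Nullary using (¬_)
open import Relation.Binary.PropositionalEquality using (_≡_; _≢_)
open import Function.Definitions using (Injective)

record Graph {a} (V : Set a) ℓ : Set (a ⊔ Level.suc ℓ) where
  field
    Adj   : V → V → Set ℓ
    sym   : ∀ {x y} → Adj x y → Adj y x
    irrefl : ∀ {x} → ¬ Adj x x
open Graph public

record InducedEmbedding {a ℓ} {V : Set a} (G : Graph V ℓ) {k : ℕ}
                        (H : Fin k → Fin k → Set) : Set (a ⊔ ℓ) where
  field
    emb      : Fin k → V
    inj      : ∀ i j → emb i ≡ emb j → i ≡ j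
    adj→     : ∀ i j → H i j → Adj G (emb i) (emb j)
    adj←     : ∀ i j → Adj G (emb i) (emb j) → H i j

ContainsInduced : ∀ {a ℓ} {V : Set a} (G : Graph V ℓ) {k : ℕ}
                  (H : Fin k → Fin k → Set) → Set (a ⊔ ℓ)
ContainsInduced G H = InducedEmbedding G H

data BullE : Fin 5 → Fin 5 → Set where
  e12 : BullE zero (suc zero)
  e23 : BullE (suc zero) (suc (suc zero))
  e34 : BullE (suc (suc zero)) (suc (suc (suc zero)))
  e45 : BullE (suc (suc (suc zero))) (suc (suc (suc (suc zero))))
  e24 : BullE (suc zero) (suc (suc (suc zero)))

Bull : Fin 5 → Fin 5 → Set
Bull i j = BullE i j ⊎ BullE j i

data ChairE : Fin 5 → Fin 5 → Set where
  c01 : ChairE zero (suc zero)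
  c02 : ChairE zero (suc (suc zero))
  c04 : ChairE zero (suc (suc (suc (suc zero))))
  c43 : ChairE (suc (suc (suc (suc zero)))) (suc (suc (suc zero)))

Chair : Fin 5 → Fin 5 → Set
Chair i j = ChairE i j ⊎ ChairE j i

Succ : {p : ℕ} .{{_ : NonZero p}} → Fin p → Fin p → Set
Succ {p} i j = toℕ j ≡ (toℕ i + 1) % p

Consec : {p : ℕ} .{{_ : NonZero p}} → Fin p → Fin p → Set
Consec i j = Succ i j ⊎ Succ j i

record IsOddAntihole {a ℓ} {V : Set a} (G : Graph V ℓ) (p : ℕ) .{{_ : NonZero p}}
                     (v : Fin p → V) : Set (a ⊔ ℓ) where
  field
    odd   : p % 2 ≡ 1
    five≤ : 5 ≤ p
    inj   : ∀ i j → v i ≡ v j → i ≡ j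
    edge  : ∀ i j → i ≢ j → ¬ Consec i j → Adj G (v i) (v j)
    nonedge : ∀ i j → Consec i j → ¬ Adj G (v i) (v j)

-- In the antihole, four cyclically consecutive vertices v₀ v₁ v₂ v₃ induce the path
-- v₁ – v₃ – v₀ – v₂. A vertex w outside the antihole that misses v₁ and v₂ but sees v₀
-- would, together with this path, induce a bull (if w sees v₃) or a chair (if not).
-- Hence w missing two consecutive vertices also misses the vertex before them, and
-- walking backwards around the cycle, w misses every vertex of the antihole.
module Submission where

open import Defs
open import Data.Nat using (ℕ; NonZero; >-nonZero; suc; _+_; _*_; _%_; _/_; _≤_; _<_; _<′_; z≤n; s≤s; ≤′-refl; ≤′-step)
open import Data.Nat.Properties using (+-comm; +-suc; +-cancelʳ-≡; ≤-refl; ≤-trans; n≤1+n; m≤n+m; m+n≤o⇒n≤o; <⇒<′)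
open import Data.Nat.DivMod using (_mod_; m≡m%n+[m/n]*n; %-distribˡ-+; m%n%n≡m%n; m%n<n; [m+n]%n≡m%n; m<n⇒m%n≡m)
open import Data.Nat.Divisibility using (_∣_; divides; >⇒∤)
open import Data.Fin using (Fin; toℕ)
open import Data.Fin.Patterns using (0F; 1F; 2F; 3F; 4F)
open import Data.Fin.Properties using (toℕ-fromℕ<; toℕ-injective; toℕ<n)
open import Data.Vec using (Vec; []; _∷_; lookup)
open import Data.Vec.Relation.Unary.AllPairs using ([]; _∷_)
open import Data.Vec.Relation.Unary.All using ([]; _∷_)
open import Data.Vec.Relation.Unary.Unique.Propositional using (Unique)
open import Data.Vec.Relation.Unary.Unique.Propositional.Properties using (lookup-injective)
open import Data.Product using (∃; _×_; _,_)
open import Data.Sum using (inj₁; inj₂)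
open import Data.Empty using (⊥; ⊥-elim)
open import Function using (_∘_)
open import Relation.Nullary using (¬_; yes; no)
open import Relation.Nullary.Decidable using (¬¬-excluded-middle)
open import Relation.Binary.PropositionalEquality
  using (_≡_; _≢_; refl; trans; cong; subst; ≢-sym; module ≡-Reasoning)
import Relation.Binary.PropositionalEquality as ≡

module _ {a ℓ} {V : Set a} (G : Graph V ℓ) where

  infix 4 _~_
  _~_ : V → V → Set ℓ
  _~_ = Adj G

  adj⇒≢ : ∀ {x y} → x ~ y → x ≢ y
  adj⇒≢ {x} x~y refl = irrefl G x~y

  separated⇒≢ : ∀ {x y z} → x ~ z → ¬ y ~ z → x ≢ y
  separated⇒≢ x~z y≁z refl = y≁z x~z

  record IsInducedP₄ (x₀ x₁ x₂ x₃ : V) : Set ℓ where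
    field
      adj₀₁ : x₀ ~ x₁
      adj₁₂ : x₁ ~ x₂
      adj₂₃ : x₂ ~ x₃
      nonadj₀₂ : ¬ x₀ ~ x₂
      nonadj₁₃ : ¬ x₁ ~ x₃
      nonadj₀₃ : ¬ x₀ ~ x₃

  module _ {x₀ x₁ x₂ x₃ w : V} (P : IsInducedP₄ x₀ x₁ x₂ x₃)
           (w~x₂ : w ~ x₂) (w≁x₀ : ¬ w ~ x₀) (w≁x₃ : ¬ w ~ x₃) (w≢x₃ : w ≢ x₃) where
    open IsInducedP₄ P

    private
      x₀≢x₁ : x₀ ≢ x₁
      x₀≢x₁ = adj⇒≢ adj₀₁
      x₀≢x₂ : x₀ ≢ x₂
      x₀≢x₂ = ≢-sym (separated⇒≢ adj₂₃ nonadj₀₃)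
      x₀≢x₃ : x₀ ≢ x₃
      x₀≢x₃ = separated⇒≢ adj₀₁ (nonadj₁₃ ∘ sym G)
      x₀≢w : x₀ ≢ w
      x₀≢w = ≢-sym (separated⇒≢ w~x₂ nonadj₀₂)
      x₁≢x₂ : x₁ ≢ x₂
      x₁≢x₂ = adj⇒≢ adj₁₂
      x₁≢x₃ : x₁ ≢ x₃
      x₁≢x₃ = separated⇒≢ (sym G adj₀₁) (nonadj₀₃ ∘ sym G)
      x₁≢w : x₁ ≢ w
      x₁≢w = separated⇒≢ (sym G adj₀₁) w≁x₀
      x₂≢x₃ : x₂ ≢ x₃
      x₂≢x₃ = adj⇒≢ adj₂₃
      x₂≢w : x₂ ≢ w
      x₂≢w = adj⇒≢ (sym G w~x₂)

    P₄-with-triangle⇒Bull : w ~ x₁ → ContainsInduced G Bull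
    P₄-with-triangle⇒Bull w~x₁ = record
      { emb = lookup vs ; inj = lookup-injective unique ; adj→ = preserves ; adj← = reflects }
      where
      vs : Vec V 5
      vs = x₀ ∷ x₁ ∷ w ∷ x₂ ∷ x₃ ∷ []

      unique : Unique vs
      unique = (x₀≢x₁ ∷ x₀≢w ∷ x₀≢x₂ ∷ x₀≢x₃ ∷ []) ∷ (x₁≢w ∷ x₁≢x₂ ∷ x₁≢x₃ ∷ [])
             ∷ (≢-sym x₂≢w ∷ w≢x₃ ∷ []) ∷ (x₂≢x₃ ∷ []) ∷ [] ∷ []

      edge : ∀ {i j} → BullE i j → lookup vs i ~ lookup vs j
      edge e12 = adj₀₁
      edge e23 = sym G w~x₁
      edge e34 = w~x₂
      edge e45 = adj₂₃
      edge e24 = adj₁₂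

      preserves : ∀ i j → Bull i j → lookup vs i ~ lookup vs j
      preserves _ _ (inj₁ e) = edge e
      preserves _ _ (inj₂ e) = sym G (edge e)

      reflects : ∀ i j → lookup vs i ~ lookup vs j → Bull i j
      reflects 0F 0F h = ⊥-elim (irrefl G h)
      reflects 0F 1F _ = inj₁ e12
      reflects 0F 2F h = ⊥-elim (w≁x₀ (sym G h))
      reflects 0F 3F h = ⊥-elim (nonadj₀₂ h)
      reflects 0F 4F h = ⊥-elim (nonadj₀₃ h)
      reflects 1F 0F _ = inj₂ e12
      reflects 1F 1F h = ⊥-elim (irrefl G h)
      reflects 1F 2F _ = inj₁ e23
      reflects 1F 3F _ = inj₁ e24
      reflects 1F 4F h = ⊥-elim (nonadj₁₃ h)
      reflects 2F 0F h = ⊥-elim (w≁x₀ h)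
      reflects 2F 1F _ = inj₂ e23
      reflects 2F 2F h = ⊥-elim (irrefl G h)
      reflects 2F 3F _ = inj₁ e34
      reflects 2F 4F h = ⊥-elim (w≁x₃ h)
      reflects 3F 0F h = ⊥-elim (nonadj₀₂ (sym G h))
      reflects 3F 1F _ = inj₂ e24
      reflects 3F 2F _ = inj₂ e34
      reflects 3F 3F h = ⊥-elim (irrefl G h)
      reflects 3F 4F _ = inj₁ e45
      reflects 4F 0F h = ⊥-elim (nonadj₀₃ (sym G h))
      reflects 4F 1F h = ⊥-elim (nonadj₁₃ (sym G h))
      reflects 4F 2F h = ⊥-elim (w≁x₃ (sym G h))
      reflects 4F 3F _ = inj₂ e45
      reflects 4F 4F h = ⊥-elim (irrefl G h)

    P₄-with-pendant⇒Chair : ¬ w ~ x₁ → ContainsInduced G Chair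
    P₄-with-pendant⇒Chair w≁x₁ = record
      { emb = lookup vs ; inj = lookup-injective unique ; adj→ = preserves ; adj← = reflects }
      where
      vs : Vec V 5
      vs = x₂ ∷ x₃ ∷ w ∷ x₀ ∷ x₁ ∷ []

      unique : Unique vs
      unique = (x₂≢x₃ ∷ x₂≢w ∷ ≢-sym x₀≢x₂ ∷ ≢-sym x₁≢x₂ ∷ [])
             ∷ (≢-sym w≢x₃ ∷ ≢-sym x₀≢x₃ ∷ ≢-sym x₁≢x₃ ∷ [])
             ∷ (≢-sym x₀≢w ∷ ≢-sym x₁≢w ∷ []) ∷ (x₀≢x₁ ∷ []) ∷ [] ∷ []

      edge : ∀ {i j} → ChairE i j → lookup vs i ~ lookup vs j
      edge c01 = adj₂₃
      edge c02 = sym G w~x₂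
      edge c04 = sym G adj₁₂
      edge c43 = sym G adj₀₁

      preserves : ∀ i j → Chair i j → lookup vs i ~ lookup vs j
      preserves _ _ (inj₁ e) = edge e
      preserves _ _ (inj₂ e) = sym G (edge e)

      reflects : ∀ i j → lookup vs i ~ lookup vs j → Chair i j
      reflects 0F 0F h = ⊥-elim (irrefl G h)
      reflects 0F 1F _ = inj₁ c01
      reflects 0F 2F _ = inj₁ c02
      reflects 0F 3F h = ⊥-elim (nonadj₀₂ (sym G h))
      reflects 0F 4F _ = inj₁ c04
      reflects 1F 0F _ = inj₂ c01
      reflects 1F 1F h = ⊥-elim (irrefl G h)
      reflects 1F 2F h = ⊥-elim (w≁x₃ (sym G h))
      reflects 1F 3F h = ⊥-elim (nonadj₀₃ (sym G h))
      reflects 1F 4F h = ⊥-elim (nonadj₁₃ (sym G h))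
      reflects 2F 0F _ = inj₂ c02
      reflects 2F 1F h = ⊥-elim (w≁x₃ h)
      reflects 2F 2F h = ⊥-elim (irrefl G h)
      reflects 2F 3F h = ⊥-elim (w≁x₀ h)
      reflects 2F 4F h = ⊥-elim (w≁x₁ h)
      reflects 3F 0F h = ⊥-elim (nonadj₀₂ h)
      reflects 3F 1F h = ⊥-elim (nonadj₀₃ h)
      reflects 3F 2F h = ⊥-elim (w≁x₀ (sym G h))
      reflects 3F 3F h = ⊥-elim (irrefl G h)
      reflects 3F 4F _ = inj₂ c43
      reflects 4F 0F _ = inj₂ c04
      reflects 4F 1F h = ⊥-elim (nonadj₁₃ h)
      reflects 4F 2F h = ⊥-elim (w≁x₁ (sym G h))
      reflects 4F 3F _ = inj₁ c43
      reflects 4F 4F h = ⊥-elim (irrefl G h)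

    bull-chair-free⇒P₄-inner-neighbour-sees-an-end :
      ¬ ContainsInduced G Bull → ¬ ContainsInduced G Chair → ⊥
    bull-chair-free⇒P₄-inner-neighbour-sees-an-end noBull noChair = ¬¬-excluded-middle λ
      { (yes w~x₁) → noBull (P₄-with-triangle⇒Bull w~x₁)
      ; (no w≁x₁)  → noChair (P₄-with-pendant⇒Chair w≁x₁) }

module Cyclic (p : ℕ) .{{_ : NonZero p}} where
  open ≡-Reasoning

  [m%p+n]%p≡[m+n]%p : ∀ m n → (m % p + n) % p ≡ (m + n) % p
  [m%p+n]%p≡[m+n]%p m n = begin
    (m % p + n) % p          ≡⟨ %-distribˡ-+ (m % p) n p ⟩
    (m % p % p + n % p) % p  ≡⟨ cong (λ t → (t + n % p) % p) (m%n%n≡m%n m p) ⟩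
    (m % p + n % p) % p      ≡⟨ %-distribˡ-+ m n p ⟨
    (m + n) % p              ∎

  toℕ-mod : ∀ n → toℕ (n mod p) ≡ n % p
  toℕ-mod n = toℕ-fromℕ< (m%n<n n p)

  %≡⇒mod≡ : ∀ {m n} → m % p ≡ n % p → m mod p ≡ n mod p
  %≡⇒mod≡ {m} {n} eq = toℕ-injective (trans (toℕ-mod m) (trans eq (≡.sym (toℕ-mod n))))

  mod≡⇒%≡ : ∀ {m n} → m mod p ≡ n mod p → m % p ≡ n % p
  mod≡⇒%≡ {m} {n} eq = trans (≡.sym (toℕ-mod m)) (trans (cong toℕ eq) (toℕ-mod n))

  toℕ-mod-inverse : ∀ (i : Fin p) → toℕ i mod p ≡ i
  toℕ-mod-inverse i = toℕ-injective (trans (toℕ-mod (toℕ i)) (m<n⇒m%n≡m (toℕ<n i)))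

  Succ-mod : ∀ y → Succ (y mod p) (suc y mod p)
  Succ-mod y = begin
    toℕ (suc y mod p)        ≡⟨ toℕ-mod (suc y) ⟩
    suc y % p                ≡⟨ cong (_% p) (+-comm 1 y) ⟩
    (y + 1) % p              ≡⟨ [m%p+n]%p≡[m+n]%p y 1 ⟨
    (y % p + 1) % p          ≡⟨ cong (λ t → (t + 1) % p) (toℕ-mod y) ⟨
    (toℕ (y mod p) + 1) % p  ∎

  Succ-functional : ∀ {i j k : Fin p} → Succ i j → Succ i k → j ≡ k
  Succ-functional i→j i→k = toℕ-injective (trans i→j (≡.sym i→k))

  [e+y]%p≡y%p⇒p∣e : ∀ e y → (e + y) % p ≡ y % p → p ∣ e
  [e+y]%p≡y%p⇒p∣e e y eq = divides q (+-cancelʳ-≡ r e (q * p) (begin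
    e + r                    ≡⟨ m≡m%n+[m/n]*n (e + r) p ⟩
    (e + r) % p + q * p      ≡⟨ cong (_+ q * p) [e+r]%p≡r ⟩
    r + q * p                ≡⟨ +-comm r (q * p) ⟩
    q * p + r                ∎))
    where
    r = y % p
    q = (e + r) / p
    [e+r]%p≡r : (e + r) % p ≡ r
    [e+r]%p≡r = begin
      (e + r) % p  ≡⟨ cong (_% p) (+-comm e r) ⟩
      (r + e) % p  ≡⟨ [m%p+n]%p≡[m+n]%p y e ⟩
      (y + e) % p  ≡⟨ cong (_% p) (+-comm y e) ⟩
      (e + y) % p  ≡⟨ eq ⟩
      r            ∎

  mod-offset-≢ : ∀ {e} y → 0 < e → e < p → (e + y) mod p ≢ y mod p
  mod-offset-≢ {e} y 0<e e<p eq =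
    >⇒∤ {{>-nonZero 0<e}} e<p ([e+y]%p≡y%p⇒p∣e e y (mod≡⇒%≡ eq))

  ¬Consec-offset : ∀ d y → 2 ≤ d → 2 + d ≤ p → ¬ Consec (y mod p) ((d + y) mod p)
  ¬Consec-offset (suc d) y (s≤s 1≤d) d+3≤p (inj₁ y→d+y) =
    mod-offset-≢ (suc y) 1≤d (m+n≤o⇒n≤o 2 d+3≤p)
      (trans (cong (_mod p) (+-suc d y)) (Succ-functional y→d+y (Succ-mod y)))
  ¬Consec-offset (suc d) y _ d+3≤p (inj₂ d+y→y) =
    mod-offset-≢ y (s≤s z≤n) d+3≤p (≡.sym (Succ-functional d+y→y (Succ-mod (suc d + y))))

module _ {a ℓ} {V : Set a} (G : Graph V ℓ) {p : ℕ} .{{_ : NonZero p}} {v : Fin p → V}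
         (AH : IsOddAntihole G p v) where
  open IsOddAntihole AH
  open Cyclic p

  vertex : ℕ → V
  vertex n = v (n mod p)

  vertex-nonadj-suc : ∀ y → ¬ Adj G (vertex y) (vertex (suc y))
  vertex-nonadj-suc y = nonedge _ _ (inj₁ (Succ-mod y))

  vertex-adj-offset : ∀ d y → 2 ≤ d → 2 + d ≤ p → Adj G (vertex y) (vertex (d + y))
  vertex-adj-offset d y 2≤d d+2≤p =
    edge _ _ (≢-sym (mod-offset-≢ y (≤-trans (s≤s z≤n) 2≤d) (m+n≤o⇒n≤o 1 d+2≤p)))
      (¬Consec-offset d y 2≤d d+2≤p)

  consecutive-P₄ : ∀ y → IsInducedP₄ G (vertex (1 + y)) (vertex (3 + y)) (vertex y) (vertex (2 + y))
  consecutive-P₄ y = record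
    { adj₀₁    = vertex-adj-offset 2 (1 + y) ≤-refl 4≤p
    ; adj₁₂    = sym G (vertex-adj-offset 3 y (n≤1+n 2) five≤)
    ; adj₂₃    = vertex-adj-offset 2 y ≤-refl 4≤p
    ; nonadj₀₂ = vertex-nonadj-suc y ∘ sym G
    ; nonadj₁₃ = vertex-nonadj-suc (2 + y) ∘ sym G
    ; nonadj₀₃ = vertex-nonadj-suc (1 + y)
    }
    where
    4≤p : 4 ≤ p
    4≤p = ≤-trans (n≤1+n 4) five≤

  module _ (noBull : ¬ ContainsInduced G Bull) (noChair : ¬ ContainsInduced G Chair)
           {w : V} (w∉ : ∀ i → w ≢ v i) where

    misses-previous : ∀ y → ¬ Adj G w (vertex (1 + y)) → ¬ Adj G w (vertex (2 + y)) →
                      ¬ Adj G w (vertex y)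
    misses-previous y w≁y+1 w≁y+2 w~y =
      bull-chair-free⇒P₄-inner-neighbour-sees-an-end G (consecutive-P₄ y) w~y w≁y+1 w≁y+2
        (w∉ _) noBull noChair

    misses-below : ∀ {y z} → y <′ z → ¬ Adj G w (vertex z) → ¬ Adj G w (vertex (suc z)) →
                   ¬ Adj G w (vertex y)
    misses-below {y} ≤′-refl       = misses-previous y
    misses-below (≤′-step y<z) w≁z w≁z+1 = misses-below y<z (misses-previous _ w≁z w≁z+1) w≁z

lemma3p1 : ∀ {a ℓ} {V : Set a} (G : Graph V ℓ) →
    ¬ ContainsInduced G Bull → ¬ ContainsInduced G Chair →
    (p : ℕ) .{{_ : NonZero p}} (v : Fin p → V) → IsOddAntihole G p v →
    (w : V) → (∀ i → w ≢ v i) → (∃ λ i → Adj G w (v i)) →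
    ¬ (∃ λ i → ∃ λ j → Succ i j × ¬ Adj G w (v i) × ¬ Adj G w (v j))
lemma3p1 G noBull noChair p v AH w w∉ (k , w~k) (i , j , i→j , w≁i , w≁j) =
  misses-below G AH noBull noChair w∉ (<⇒<′ k<z)
    (subst (λ t → ¬ Adj G w (v t)) (≡.sym z≡i) w≁i)
    (subst (λ t → ¬ Adj G w (v t)) (≡.sym z+1≡j) w≁j)
    (subst (λ t → Adj G w (v t)) (≡.sym (toℕ-mod-inverse k)) w~k)
  where
  open Cyclic p
  z = toℕ i + p
  k<z : toℕ k < z
  k<z = ≤-trans (toℕ<n k) (m≤n+m p (toℕ i))
  z≡i : z mod p ≡ i
  z≡i = trans (%≡⇒mod≡ ([m+n]%n≡m%n (toℕ i) p)) (toℕ-mod-inverse i)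
  z+1≡j : suc z mod p ≡ j
  z+1≡j = Succ-functional (subst (λ t → Succ t (suc z mod p)) z≡i (Succ-mod z)) i→j
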